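{- Let $\mathcal{M}=(W,R,V)$ be a Kripke model, $w\in W$, $\varphi$ a sentence of the modal $\mu$-calculus and $\Gamma>0$ an ordinal. Every play of the $\Gamma$-bounded evaluation game $\mathcal{G}=(\mathcal{M},w,\varphi,\Gamma)$ ends after a finite number of rounds.
   Context: Formulae of the modal $\mu$-calculus over a set $\Phi$ of proposition symbols and a set $\Lambda$ of label symbols are generated by $\varphi ::= p \mid \neg p \mid X \mid \varphi\vee\varphi \mid \varphi\wedge\varphi \mid \Diamond\varphi \mid \Box\varphi \mid \mu X\varphi \mid \nu X\varphi$ with $p\in\Phi$, $X\in\Lambda$. $\mathrm{Sub}(\varphi)$ is the set of nodes of the syntax tree of $\varphi$ (different occurrences of the same subformula are distinguished), and $\mathrm{Sub}_{\mu\nu}(\varphi)$ is the set of those nodes of the form $\mu X\psi$ or $\nu X\psi$. A label $X$ occurs free if some occurrence of it is not inside a subformula $\mu X\psi$ or $\nu X\psi$; a sentence has no free labels. For an occurrence of a label $X$ in a sentence $\varphi_0$, its reference formula $\mathrm{rf}(X)$ is the unique subformula of the form $\mu X\psi$ or $\nu X\psi$ on the path from the root to that occurrence such that no other operator $\mu X$ or $\nu X$ lies between it and the occurrence. A Kripke model is $\mathcal{M}=(W,R,V)$ with $W\neq\emptyset$, $R\subseteq W\times W$, $V:\Phi\to\mathcal{P}(W)$. The $\Gamma$-bounded evaluation game $(\mathcal{M},w_0,\varphi_0,\Gamma)$ (for an ordinal $\Gamma>0$) is played by Eloise and Abelard. Positions are triples $(w,\varphi,c)$ with $w\in W$, $\varphi\in\mathrm{Sub}(\varphi_0)$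 and a clock mapping $c:\mathrm{Sub}_{\mu\nu}(\varphi_0)\to\{\gamma\mid\gamma\le\Gamma\}$. The initial position is $(w_0,\varphi_0,c_0)$ with $c_0(\theta)=\Gamma$ for all $\theta$. Rules: at $(w,p,c)$ Eloise wins iff $w\in V(p)$, otherwise Abelard wins; at $(w,\neg p,c)$ Eloise wins iff $w\notin V(p)$, otherwise Abelard wins; at $(w,\psi\vee\theta,c)$ Eloise chooses the next position $(w,\psi,c)$ or $(w,\theta,c)$; at $(w,\psi\wedge\theta,c)$ Abelard chooses likewise; at $(w,\Diamond\psi,c)$ Eloise chooses $v$ with $wRv$ and play moves to $(v,\psi,c)$, and if there is no such $v$ Abelard wins; at $(w,\Box\psi,c)$ Abelard chooses $v$ with $wRv$ and play moves to $(v,\psi,c)$, and if there is no such $v$ Eloise wins; at $(w,\mu X\psi,c)$ Eloise chooses an ordinal $\gamma<\Gamma$ and play moves to $(w,\psi,c[\gamma/\mu X\psi])$ (where $c[\gamma/\theta]$ sends $\theta$ to $\gamma$ and agrees with $c$ elsewhere); at $(w,\nu X\psi,c)$ Abelard chooses $\gamma<\Gamma$ and play moves to $(w,\psi,c[\gamma/\nu X\psi])$. At $(w,X,c)$ let $\gamma=c(\mathrm{rf}(X))$. If $\mathrm{rf}(X)=\mu X\psi$: if $\gamma=0$ Abelard wins, otherwise Eloise chooses $\gamma'<\gamma$ and play moves to $(w,\psi,c')$ where $c'(\mu X\psi)=\gamma'$, $c'(\theta)=\Gamma$ for every $\theta\in\mathrm{Sub}_{\mu\nu}(\varphi_0)$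 lying in $\mathrm{Sub}(\psi)$, and $c'(\theta)=c(\theta)$ otherwise. If $\mathrm{rf}(X)=\nu X\psi$: the same with the roles of Eloise and Abelard swapped (if $\gamma=0$ Eloise wins; otherwise Abelard chooses $\gamma'<\gamma$). A round is the execution of the rule at one position. -}

module Defs where

open import Data.Nat using (ℕ; suc)
open import Data.List using (List; []; _∷_; _++_; [_])
open import Data.Maybe using (Maybe; just; nothing)
open import Data.Product using (Σ; ∃; _×_; _,_)
open import Data.Sum using (_⊎_)
open import Data.Empty using (⊥)
open import Relation.Nullary using (¬_)
open import Relation.Binary.Core using (Rel)
open import Relation.Binary.Structures using (IsStrictTotalOrder)
open import Relation.Binary.PropositionalEquality using (_≡_; _≢_)
open import Induction.WellFounded using (WellFounded)
open import Level using (0ℓ)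

-- Syntax of the modal μ-calculus over proposition symbols P (= Φ) and
-- label symbols L (= Λ).

data Formula (P L : Set) : Set where
  atom  : P → Formula P L
  natom : P → Formula P L
  var   : L → Formula P L
  _∨ᶠ_  : Formula P L → Formula P L → Formula P L
  _∧ᶠ_  : Formula P L → Formula P L → Formula P L
  ◇_    : Formula P L → Formula P L
  □_    : Formula P L → Formula P L
  μ[_]_ : L → Formula P L → Formula P L
  ν[_]_ : L → Formula P L → Formula P L

data FreeIn {P L : Set} (X : L) : Formula P L → Set where
  fv-var : FreeIn X (var X)
  fv-∨l  : ∀ {φ ψ} → FreeIn X φ → FreeIn X (φ ∨ᶠ ψ)
  fv-∨r  : ∀ {φ ψ} → FreeIn X ψ → FreeIn X (φ ∨ᶠ ψ)
  fv-∧l  : ∀ {φ ψ} → FreeIn X φ → FreeIn X (φ ∧ᶠ ψ)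
  fv-∧r  : ∀ {φ ψ} → FreeIn X ψ → FreeIn X (φ ∧ᶠ ψ)
  fv-◇   : ∀ {φ} → FreeIn X φ → FreeIn X (◇ φ)
  fv-□   : ∀ {φ} → FreeIn X φ → FreeIn X (□ φ)
  fv-μ   : ∀ {Y φ} → Y ≢ X → FreeIn X φ → FreeIn X (μ[ Y ] φ)
  fv-ν   : ∀ {Y φ} → Y ≢ X → FreeIn X φ → FreeIn X (ν[ Y ] φ)

Sentence : {P L : Set} → Formula P L → Set
Sentence {L = L} φ = (X : L) → ¬ FreeIn X φ

-- Nodes of the syntax tree (occurrences), addressed by paths from the root.

data Dir : Set where
  left right down : Dir

Path : Set
Path = List Dir

at : {P L : Set} → Formula P L → Path → Maybe (Formula P L)
at φ []                        = just φ
at (φ ∨ᶠ ψ)   (left  ∷ p)      = at φ p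
at (φ ∨ᶠ ψ)   (right ∷ p)      = at ψ p
at (φ ∧ᶠ ψ)   (left  ∷ p)      = at φ p
at (φ ∧ᶠ ψ)   (right ∷ p)      = at ψ p
at (◇ φ)      (down  ∷ p)      = at φ p
at (□ φ)      (down  ∷ p)      = at φ p
at (μ[ X ] φ) (down  ∷ p)      = at φ p
at (ν[ X ] φ) (down  ∷ p)      = at φ p
at _          (_     ∷ _)      = nothing

_⊑_ : Path → Path → Set
p ⊑ q = ∃ λ r → q ≡ p ++ r

_⊏_ : Path → Path → Set
p ⊏ q = Σ Dir λ d → ∃ λ r → q ≡ p ++ (d ∷ r)

record Kripke (P : Set) : Set₁ where
  field
    W : Set
    R : W → W → Set
    V : P → W → Set

-- The ordinals ≤ Γ: a well-order (strict total, well-founded) with a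
-- greatest element Γ.  Every such structure is isomorphic to
-- {γ | γ ≤ Γ} for an ordinal Γ, and conversely.

record OrdinalsUpTo : Set₁ where
  field
    Ord               : Set
    _<_               : Rel Ord 0ℓ
    isStrictTotalOrder : IsStrictTotalOrder _≡_ _<_
    wellFounded       : WellFounded _<_
    Γ                 : Ord
    Γ-greatest        : (γ : Ord) → γ ≡ Γ ⊎ γ < Γ

module Game {P L : Set} (M : Kripke P) (φ₀ : Formula P L) (Ω : OrdinalsUpTo) where
  open Kripke M
  open OrdinalsUpTo Ω

  -- clocks; only the values on μ/ν-nodes are ever read or changed
  Clock : Set
  Clock = Path → Ord

  record Position : Set where
    constructor ⟨_,_,_⟩
    field
      world : W
      node  : Path
      clock : Clock

  IsFixNode : Path → Set
  IsFixNode q = Σ L λ Y → Σ (Formula P L) λ χ →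
                  (at φ₀ q ≡ just (μ[ Y ] χ)) ⊎ (at φ₀ q ≡ just (ν[ Y ] χ))

  BindsAt : Path → L → Set
  BindsAt b X = Σ (Formula P L) λ χ →
                  (at φ₀ b ≡ just (μ[ X ] χ)) ⊎ (at φ₀ b ≡ just (ν[ X ] χ))

  RefersTo : Path → L → Path → Set
  RefersTo p X b = b ⊏ p × BindsAt b X ×
                   ((b' : Path) → b ⊏ b' → b' ⊑ p → ¬ BindsAt b' X)

  Update : Clock → Path → Ord → Clock → Set
  Update c θ γ c' = (q : Path) → (q ≡ θ → c' q ≡ γ) × (q ≢ θ → c' q ≡ c q)

  Regenerate : Clock → Path → Ord → Clock → Set
  Regenerate c b γ' c' =
    (q : Path) →
      (q ≡ b → c' q ≡ γ')
    × ((b ++ [ down ]) ⊑ q → IsFixNode q → c' q ≡ Γ)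
    × (q ≢ b → ¬ ((b ++ [ down ]) ⊑ q × IsFixNode q) → c' q ≡ c q)

  -- One round: the legal moves (of whichever player is to move).
  -- Positions without any move are exactly those where the play ends.
  data Move : Position → Position → Set where
    ∨-left  : ∀ {w p c ψ θ} → at φ₀ p ≡ just (ψ ∨ᶠ θ) →
              Move ⟨ w , p , c ⟩ ⟨ w , p ++ [ left ] , c ⟩
    ∨-right : ∀ {w p c ψ θ} → at φ₀ p ≡ just (ψ ∨ᶠ θ) →
              Move ⟨ w , p , c ⟩ ⟨ w , p ++ [ right ] , c ⟩
    ∧-left  : ∀ {w p c ψ θ} → at φ₀ p ≡ just (ψ ∧ᶠ θ) →
              Move ⟨ w , p , c ⟩ ⟨ w , p ++ [ left ] , c ⟩
    ∧-right : ∀ {w p c ψ θ} → at φ₀ p ≡ just (ψ ∧ᶠ θ) →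
              Move ⟨ w , p , c ⟩ ⟨ w , p ++ [ right ] , c ⟩
    ◇-move  : ∀ {w v p c ψ} → at φ₀ p ≡ just (◇ ψ) → R w v →
              Move ⟨ w , p , c ⟩ ⟨ v , p ++ [ down ] , c ⟩
    □-move  : ∀ {w v p c ψ} → at φ₀ p ≡ just (□ ψ) → R w v →
              Move ⟨ w , p , c ⟩ ⟨ v , p ++ [ down ] , c ⟩
    μ-move  : ∀ {w p c c' X ψ γ} → at φ₀ p ≡ just (μ[ X ] ψ) →
              γ < Γ → Update c p γ c' →
              Move ⟨ w , p , c ⟩ ⟨ w , p ++ [ down ] , c' ⟩
    ν-move  : ∀ {w p c c' X ψ γ} → at φ₀ p ≡ just (ν[ X ] ψ) →
              γ < Γ → Update c p γ c' →
              Move ⟨ w , p , c ⟩ ⟨ w , p ++ [ down ] , c' ⟩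
    μ-var   : ∀ {w p c c' X b ψ γ'} → at φ₀ p ≡ just (var X) →
              RefersTo p X b → at φ₀ b ≡ just (μ[ X ] ψ) →
              γ' < c b → Regenerate c b γ' c' →
              Move ⟨ w , p , c ⟩ ⟨ w , b ++ [ down ] , c' ⟩
    ν-var   : ∀ {w p c c' X b ψ γ'} → at φ₀ p ≡ just (var X) →
              RefersTo p X b → at φ₀ b ≡ just (ν[ X ] ψ) →
              γ' < c b → Regenerate c b γ' c' →
              Move ⟨ w , p , c ⟩ ⟨ w , b ++ [ down ] , c' ⟩

  IsInitial : W → Position → Set
  IsInitial w₀ ⟨ w , p , c ⟩ =
    w ≡ w₀ × p ≡ [] × ((q : Path) → IsFixNode q → c q ≡ Γ)

  InfinitePlay : W → Set
  InfinitePlay w₀ = Σ (ℕ → Position) λ play →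
    IsInitial w₀ (play 0) × ((n : ℕ) → Move (play n) (play (suc n)))

-- Rank a position by the clock values on the path from the root of φ₀ to
-- its node, padded with a top element ⊤ up to the height of φ₀, and order
-- ranks lexicographically.  Descending to a child replaces a ⊤ by a clock
-- value.  A fixpoint variable jumps back to its binder b and strictly
-- lowers the clock at b, while the clock reset only touches nodes strictly
-- below b, so the ranks of b's ancestors are unchanged.  Hence every round
-- lowers the rank, and the lexicographic order on vectors of fixed length
-- over a well-order with a top added is well-founded.
module Submission where

open import Defs
open import Data.Product using (∃; _,_; proj₁; proj₂)
open import Relation.Nullary using (¬_)
open import Data.Nat using (ℕ; zero; suc; _+_; _⊔_; _≤_; _<_; s≤s; z≤n)
open import Data.Nat.Properties using (≤-refl; ≤-trans; <-≤-trans; m≤m⊔n; m≤n⊔m; m<m+n)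
open import Data.List using ([]; _∷_; _++_; length)
open import Data.List.Properties using (++-assoc; ++-identityʳ; ++-identityʳ-unique)
open import Data.Maybe using (just)
open import Data.Vec using (Vec) renaming ([] to []ᵥ; _∷_ to _∷ᵥ_)
import Data.Vec.Relation.Binary.Lex.Strict as VecLex
open import Function using (_∘_)
open import Induction.WellFounded using (WellFounded; Acc; acc)
open import Induction.InfiniteDescent using (InfiniteDescendingSequence)
open import Relation.Binary.Core using (Rel)
open import Relation.Binary.PropositionalEquality using (_≡_; refl; sym; trans; cong; subst; respʳ)
open import Relation.Nullary.Construct.Add.Supremum using (_⁺; ⊤⁺; [_])
import Relation.Binary.Construct.Add.Supremum.Strict as Supremum

module _ {a r} {A : Set a} {_≺_ : Rel A r} where
  open Supremum _≺_

  <⁺-wellFounded : WellFounded _≺_ → WellFounded _<⁺_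
  <⁺-wellFounded wf ⊤⁺    = acc λ { [ k ]<⊤⁺ → <⁺-wellFounded wf [ k ] }
  <⁺-wellFounded wf [ k ] = lift (wf k)
    where
      lift : ∀ {x} → Acc _≺_ x → Acc _<⁺_ [ x ]
      lift (acc rs) = acc λ { [ y≺x ] → lift (rs y≺x) }

  wellFounded⇒¬infiniteDescent : WellFounded _≺_ → {f : ℕ → A} →
                                  ¬ InfiniteDescendingSequence _≺_ f
  wellFounded⇒¬infiniteDescent wf {f} = go (wf (f 0))
    where
      go : ∀ {f} → Acc _≺_ (f 0) → ¬ InfiniteDescendingSequence _≺_ f
      go (acc rs) desc = go (rs (desc 0)) (desc ∘ suc)

height : {P L : Set} → Formula P L → ℕ
height (atom _)   = 0
height (natom _)  = 0
height (var _)    = 0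
height (φ ∨ᶠ ψ)   = suc (height φ ⊔ height ψ)
height (φ ∧ᶠ ψ)   = suc (height φ ⊔ height ψ)
height (◇ φ)      = suc (height φ)
height (□ φ)      = suc (height φ)
height (μ[ _ ] φ) = suc (height φ)
height (ν[ _ ] φ) = suc (height φ)

module _ {P L : Set} where

  depth+height≤height : {φ χ : Formula P L} (p : Path) → at φ p ≡ just χ →
                        length p + height χ ≤ height φ
  depth+height≤height                []          refl = ≤-refl
  depth+height≤height {atom _}       (_ ∷ _)     ()
  depth+height≤height {natom _}      (_ ∷ _)     ()
  depth+height≤height {var _}        (_ ∷ _)     ()
  depth+height≤height {φ ∨ᶠ ψ}       (left ∷ p)  e = s≤s (≤-trans (depth+height≤height p e) (m≤m⊔n _ _))
  depth+height≤height {φ ∨ᶠ ψ}       (right ∷ p) e = s≤s (≤-trans (depth+height≤height p e) (m≤n⊔m _ _))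
  depth+height≤height {φ ∨ᶠ ψ}       (down ∷ _)  ()
  depth+height≤height {φ ∧ᶠ ψ}       (left ∷ p)  e = s≤s (≤-trans (depth+height≤height p e) (m≤m⊔n _ _))
  depth+height≤height {φ ∧ᶠ ψ}       (right ∷ p) e = s≤s (≤-trans (depth+height≤height p e) (m≤n⊔m _ _))
  depth+height≤height {φ ∧ᶠ ψ}       (down ∷ _)  ()
  depth+height≤height {◇ φ}          (down ∷ p)  e = s≤s (depth+height≤height p e)
  depth+height≤height {◇ φ}          (left ∷ _)  ()
  depth+height≤height {◇ φ}          (right ∷ _) ()
  depth+height≤height {□ φ}          (down ∷ p)  e = s≤s (depth+height≤height p e)
  depth+height≤height {□ φ}          (left ∷ _)  ()
  depth+height≤height {□ φ}          (right ∷ _) ()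
  depth+height≤height {μ[ _ ] φ}     (down ∷ p)  e = s≤s (depth+height≤height p e)
  depth+height≤height {μ[ _ ] φ}     (left ∷ _)  ()
  depth+height≤height {μ[ _ ] φ}     (right ∷ _) ()
  depth+height≤height {ν[ _ ] φ}     (down ∷ p)  e = s≤s (depth+height≤height p e)
  depth+height≤height {ν[ _ ] φ}     (left ∷ _)  ()
  depth+height≤height {ν[ _ ] φ}     (right ∷ _) ()

  depth<height : {φ χ : Formula P L} (p : Path) → at φ p ≡ just χ →
                 0 < height χ → length p < height φ
  depth<height p e 0<h = <-≤-trans (m<m+n (length p) 0<h) (depth+height≤height p e)

⊑-refl : (p : Path) → p ⊑ p
⊑-refl p = [] , sym (++-identityʳ p)

⊑-trans : {p q s : Path} → p ⊑ q → q ⊑ s → p ⊑ s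
⊑-trans {p} (r₁ , refl) (r₂ , refl) = r₁ ++ r₂ , ++-assoc p r₁ r₂

⊏-cons : {q p : Path} (d : Dir) → q ⊏ p → (d ∷ q) ⊏ (d ∷ p)
⊏-cons d (e , r , eq) = e , r , cong (d ∷_) eq

⊏⇒⋣ : {q p : Path} → q ⊏ p → ¬ p ⊑ q
⊏⇒⋣ {q} (d , r , refl) (s , eq) with ++-identityʳ-unique q (trans eq (++-assoc q (d ∷ r) s))
... | ()

module Profile {a r} {A : Set a} (_≺_ : Rel A r) where
  open Supremum _≺_

  _<ₗₑₓ_ : {n : ℕ} → Rel (Vec (A ⁺) n) _
  _<ₗₑₓ_ = VecLex.Lex-< _≡_ _<⁺_

  <ₗₑₓ-wellFounded : WellFounded _≺_ → {n : ℕ} → WellFounded (_<ₗₑₓ_ {n})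
  <ₗₑₓ-wellFounded wf = VecLex.<-wellFounded trans (respʳ _<⁺_) (<⁺-wellFounded wf)

  -- Entry i is the clock at the prefix of p of length i, or ⊤ past the end
  -- of p; shifting the clock along p keeps the recursion structural.
  profile : (Path → A) → (n : ℕ) → Path → Vec (A ⁺) n
  profile c zero    _       = []ᵥ
  profile c (suc n) []      = ⊤⁺ ∷ᵥ profile c n []
  profile c (suc n) (d ∷ p) = [ c [] ] ∷ᵥ profile (c ∘ (d ∷_)) n p

  AgreeAbove : (Path → A) → (Path → A) → Path → Set a
  AgreeAbove c c' p = {q : Path} → q ⊏ p → c' q ≡ c q

  agreeAbove-cons : {c c' : Path → A} (d : Dir) {p : Path} → AgreeAbove c c' (d ∷ p) →
                    AgreeAbove (c ∘ (d ∷_)) (c' ∘ (d ∷_)) p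
  agreeAbove-cons d agree = agree ∘ ⊏-cons d

  profile-extend : {n : ℕ} (c c' : Path → A) (p : Path) (d : Dir) → length p < n →
                   AgreeAbove c c' p → profile c' n (p ++ d ∷ []) <ₗₑₓ profile c n p
  profile-extend {suc n} c c' []      d _          _     = VecLex.this [ c' [] ]<⊤⁺ refl
  profile-extend {suc n} c c' (e ∷ p) d (s≤s |p|<n) agree =
    VecLex.next (cong [_] (agree (e , p , refl)))
                (profile-extend (c ∘ (e ∷_)) (c' ∘ (e ∷_)) p d |p|<n (agreeAbove-cons e agree))

  profile-jump : {n : ℕ} (c c' : Path → A) (b : Path) {d e : Dir} {r s : Path} → length b < n →
                 AgreeAbove c c' b → c' b ≺ c b → profile c' n (b ++ e ∷ s) <ₗₑₓ profile c n (b ++ d ∷ r)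
  profile-jump {suc n} c c' []      _           _     c'b≺cb = VecLex.this [ c'b≺cb ] refl
  profile-jump {suc n} c c' (f ∷ b) (s≤s |b|<n) agree c'b≺cb =
    VecLex.next (cong [_] (agree (f , b , refl)))
                (profile-jump (c ∘ (f ∷_)) (c' ∘ (f ∷_)) b |b|<n (agreeAbove-cons f agree) c'b≺cb)

module Termination {P L : Set} (M : Kripke P) (φ₀ : Formula P L) (Ω : OrdinalsUpTo) where
  open OrdinalsUpTo Ω using (Ord) renaming (_<_ to _<ᵒ_)
  open Game M φ₀ Ω
  open Profile _<ᵒ_

  update-agreeAbove : {c c' : Clock} {p : Path} {γ : Ord} → Update c p γ c' → AgreeAbove c c' p
  update-agreeAbove {p = p} upd q⊏p = proj₂ (upd _) λ { refl → ⊏⇒⋣ q⊏p (⊑-refl p) }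

  regenerate-agreeAbove : {c c' : Clock} {b : Path} {γ : Ord} → Regenerate c b γ c' → AgreeAbove c c' b
  regenerate-agreeAbove {b = b} reg q⊏b =
    proj₂ (proj₂ (reg _))
      (λ { refl → ⊏⇒⋣ q⊏b (⊑-refl b) })
      (λ (inBody , _) → ⊏⇒⋣ q⊏b (⊑-trans (_ , refl) inBody))

  regenerate-lowers : {c c' : Clock} {b : Path} {γ : Ord} → Regenerate c b γ c' → γ <ᵒ c b → c' b <ᵒ c b
  regenerate-lowers {c = c} {b = b} reg = subst (_<ᵒ c b) (sym (proj₁ (reg b) refl))

  rank : Position → Vec (Ord ⁺) (height φ₀)
  rank ⟨ _ , p , c ⟩ = profile c (height φ₀) p

  move-decreases-rank : {x y : Position} → Move x y → rank y <ₗₑₓ rank x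
  move-decreases-rank {⟨ _ , p , c ⟩} (∨-left e) =
    profile-extend c c p left (depth<height p e (s≤s z≤n)) (λ _ → refl)
  move-decreases-rank {⟨ _ , p , c ⟩} (∨-right e) =
    profile-extend c c p right (depth<height p e (s≤s z≤n)) (λ _ → refl)
  move-decreases-rank {⟨ _ , p , c ⟩} (∧-left e) =
    profile-extend c c p left (depth<height p e (s≤s z≤n)) (λ _ → refl)
  move-decreases-rank {⟨ _ , p , c ⟩} (∧-right e) =
    profile-extend c c p right (depth<height p e (s≤s z≤n)) (λ _ → refl)
  move-decreases-rank {⟨ _ , p , c ⟩} (◇-move e _) =
    profile-extend c c p down (depth<height p e (s≤s z≤n)) (λ _ → refl)
  move-decreases-rank {⟨ _ , p , c ⟩} (□-move e _) =
    profile-extend c c p down (depth<height p e (s≤s z≤n)) (λ _ → refl)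
  move-decreases-rank {⟨ _ , p , c ⟩} {⟨ _ , _ , c' ⟩} (μ-move e _ upd) =
    profile-extend c c' p down (depth<height p e (s≤s z≤n)) (update-agreeAbove upd)
  move-decreases-rank {⟨ _ , p , c ⟩} {⟨ _ , _ , c' ⟩} (ν-move e _ upd) =
    profile-extend c c' p down (depth<height p e (s≤s z≤n)) (update-agreeAbove upd)
  move-decreases-rank {⟨ _ , _ , c ⟩} {⟨ _ , _ , c' ⟩} (μ-var {b = b} _ ((_ , _ , refl) , _) e γ'<cb reg) =
    profile-jump c c' b (depth<height b e (s≤s z≤n)) (regenerate-agreeAbove reg) (regenerate-lowers reg γ'<cb)
  move-decreases-rank {⟨ _ , _ , c ⟩} {⟨ _ , _ , c' ⟩} (ν-var {b = b} _ ((_ , _ , refl) , _) e γ'<cb reg) =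
    profile-jump c c' b (depth<height b e (s≤s z≤n)) (regenerate-agreeAbove reg) (regenerate-lowers reg γ'<cb)

proposition6 : {P L : Set} (M : Kripke P) (w : Kripke.W M)
    (φ : Formula P L) → Sentence φ →
    (Ω : OrdinalsUpTo) → ∃ (λ γ → OrdinalsUpTo._<_ Ω γ (OrdinalsUpTo.Γ Ω)) →
    ¬ Game.InfinitePlay M φ Ω w
proposition6 M w φ _ Ω _ (play , _ , moves) =
  wellFounded⇒¬infiniteDescent (<ₗₑₓ-wellFounded wellFounded) (move-decreases-rank ∘ moves)
  where
    open OrdinalsUpTo Ω using (wellFounded) renaming (_<_ to _<ᵒ_)
    open Profile _<ᵒ_ using (<ₗₑₓ-wellFounded)
    open Termination M φ Ω using (move-decreases-rank)
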